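{- Let $T$ be a tree with cost function $c:V(T)\to\mathbb{R}_{>0}$ that is $k$-up-modular in $T$, let $\mathcal{T}$ be a subtree of $T$, and let $a\ge 0$. Let $\mathcal{Z}$ and $\mathcal{T}_{\mathcal{Z}}$ be constructed from $(\mathcal{T},c,a)$ as described in the context. Then $|V(\mathcal{T}_{\mathcal{Z}})|\le 4k-3$.
   Context: Heavy modules: for a tree $G$ with costs $c$ and $t\ge 0$, a heavy module with respect to $t$ is an inclusion-maximal set $H\subseteq V(G)$ such that $G[H]$ is connected and $c(v)>t$ for all $v\in H$. $k(G,c)$ is the maximum over $t\ge 0$ of the number of heavy modules with respect to $t$; $c$ is $k$-up-modular in $G$ if $k\ge k(G,c)$. Notation: for $S\subseteq V(G)$, $G\langle S\rangle$ is the minimal connected subtree of $G$ containing $S$; for vertices $u,v$, $\mathcal{P}_G(u,v)$ is the set of vertices on the $u$–$v$ path in $G$ excluding $u$ and $v$. Construction: let $\mathcal{H}$ be the set of heavy modules of $(\mathcal{T},c)$ with respect to $a$. Let $\mathcal{X}$ contain one arbitrarily chosen vertex from each $H\in\mathcal{H}$. Let $\mathcal{Y}=\mathcal{X}\cup\{v\in V(\mathcal{T}\langle\mathcal{X}\rangle):\deg_{\mathcal{T}\langle\mathcal{X}\rangle}(v)\ge 3\}$. Let $\mathcal{Z}$ consist of $\mathcal{Y}$ together with, for every pair $u,v\in\mathcal{Y}$ with $\mathcal{P}_{\mathcal{T}}(u,v)\neq\emptyset$ and $\mathcal{P}_{\mathcal{T}}(u,v)\cap\mathcal{Y}=\emptyset$,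 a vertex of minimum cost in $\mathcal{P}_{\mathcal{T}}(u,v)$. The auxiliary tree $\mathcal{T}_{\mathcal{Z}}$ has vertex set $\mathcal{Z}$ and edges $uv$ for distinct $u,v\in\mathcal{Z}$ with $\mathcal{P}_{\mathcal{T}}(u,v)\cap\mathcal{Z}=\emptyset$.
   Formalization: The cost function $c$ takes positive rational values, and the parameter $a$ and the thresholds $t$ are rational, instead of real. -}

module Defs where

open import Data.Nat using (ℕ; _≤_)
open import Data.Bool using (Bool; true; false; _∧_)
open import Data.Fin using (Fin)
open import Data.Fin.Subset using (Subset; _∈_; _∉_; _⊆_; ∣_∣; ⊤)
open import Data.Vec using (tabulate; lookup)
open import Data.List using (List; []; _∷_; length; head; last)
open import Data.List.Membership.Propositional using () renaming (_∈_ to _∈ₗ_)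
open import Data.List.Relation.Unary.All using (All)
open import Data.List.Relation.Unary.Unique.Propositional using (Unique)
open import Data.Maybe using (Maybe; just)
open import Data.Product using (Σ; ∃; _×_)
open import Data.Sum using (_⊎_)
open import Data.Empty using (⊥)
open import Relation.Nullary using (¬_)
open import Relation.Binary.PropositionalEquality using (_≡_; _≢_)
open import Data.Rational using (ℚ; 0ℚ) renaming (_<_ to _<ℚ_; _≤_ to _≤ℚ_)

record Graph (n : ℕ) : Set where
  field
    adj    : Fin n → Fin n → Bool
    sym    : ∀ u v → adj u v ≡ adj v u
    irrefl : ∀ v → adj v v ≡ false

module _ {n : ℕ} (G : Graph n) where
  open Graph G

  Adj : Fin n → Fin n → Set
  Adj u v = adj u v ≡ true

  data Chain : List (Fin n) → Set where
    nil  : Chain []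
    one  : ∀ v → Chain (v ∷ [])
    cons : ∀ {u v vs} → Adj u v → Chain (v ∷ vs) → Chain (u ∷ v ∷ vs)

  PathIn : Subset n → Fin n → Fin n → List (Fin n) → Set
  PathIn S u v vs =
    Chain vs × Unique vs × All (λ w → w ∈ S) vs ×
    head vs ≡ just u × last vs ≡ just v

  -- G[S] is connected, allowing S = ∅ (the empty graph counts as preconnected)
  Preconnected : Subset n → Set
  Preconnected S = ∀ u v → u ∈ S → v ∈ S → ∃ λ vs → PathIn S u v vs

  Connected : Subset n → Set
  Connected S = (∃ λ v → v ∈ S) × Preconnected S

  IsCycle : List (Fin n) → Set
  IsCycle []       = ⊥
  IsCycle (u ∷ vs) =
    Chain (u ∷ vs) × Unique (u ∷ vs) × 3 ≤ length (u ∷ vs) ×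
    ∃ λ w → last (u ∷ vs) ≡ just w × Adj w u

  IsTree : Set
  IsTree = Connected ⊤ × (∀ vs → ¬ IsCycle vs)

  -- a subtree (given by its vertex set; a connected subgraph of a tree is induced)
  IsSubtree : Subset n → Set
  IsSubtree S = Connected S

  HeavyIn : Subset n → (Fin n → ℚ) → ℚ → Subset n → Set
  HeavyIn S c t H =
    H ⊆ S × Connected H × (∀ v → v ∈ H → t <ℚ c v) ×
    (∀ H' → H ⊆ H' → H' ⊆ S → Connected H' → (∀ v → v ∈ H' → t <ℚ c v) → H' ⊆ H)

  UpModular : (Fin n → ℚ) → ℕ → Set
  UpModular c k = ∀ t → 0ℚ ≤ℚ t → ∀ (Hs : List (Subset n)) → Unique Hs →
    All (HeavyIn ⊤ c t) Hs → length Hs ≤ k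

  MinSubtree : Subset n → Subset n → Subset n → Set
  MinSubtree S X K =
    X ⊆ K × K ⊆ S × Preconnected K ×
    (∀ K' → X ⊆ K' → K' ⊆ S → Preconnected K' → K ⊆ K')

  deg : Subset n → Fin n → ℕ
  deg K v = ∣ tabulate (λ u → lookup K u ∧ adj v u) ∣

  -- w ∈ 𝒫_{G[S]}(u,v): w is an inner vertex of the u–v path in G[S]
  Inner : Subset n → Fin n → Fin n → Fin n → Set
  Inner S u v w = w ≢ u × w ≢ v × ∃ λ vs → PathIn S u v vs × w ∈ₗ vs

  -- the pair u,v gets a minimum-cost vertex in 𝒵:
  -- 𝒫(u,v) ≠ ∅ and 𝒫(u,v) ∩ 𝒴 = ∅
  GoodPair : Subset n → Subset n → Fin n → Fin n → Set
  GoodPair S Y u v = (∃ λ w → Inner S u v w) × (∀ w → Inner S u v w → w ∉ Y)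

{-# OPTIONS --safe #-}
-- Root T at a representative r ∈ X and list the other representatives as ts. Distinct
-- representatives lie in distinct heavy modules of T (a heavy path joining two of them would
-- stay inside the subtree S and put both into one heavy module of S), so up-modularity gives
-- 1 + |ts| ≤ k. A vertex of Y is r, an element of ts, or a branch vertex b ≠ r of the
-- Steiner tree K; such a b has two children in K, which forces b to be the point where the
-- root path of some t ∈ ts first meets the root paths of r and of the terminals listed after
-- t. Hence |Y| ≤ 1 + 2|ts|. If no vertex of Y lies strictly between u, v ∈ Y, one of them is
-- an ancestor of the other, since otherwise the meeting point of their root paths would be r
-- or a branch vertex of K strictly between them; so the pair is {w, first Y-vertex above w}
-- for some w ∈ Y ∖ {r}. Therefore |Z| ≤ |Y| + |Y ∖ {r}| ≤ 4|ts| + 1 ≤ 4k − 3.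
module Submission where

open import Defs
open import Data.Bool using (true; false; _∧_)
open import Data.Empty using (⊥-elim)
open import Data.Fin using (Fin; zero; suc) renaming (_≟_ to _≟ᶠ_)
import Data.Fin.Properties as Finₚ
open import Data.Fin.Subset using (Subset; _∈_; _∉_; _⊆_; ∣_∣; ⊤) renaming (⊥ to ∅)
import Data.Fin.Subset.Properties as Subsetₚ
open Subsetₚ using (_∈?_)
open import Data.List
  using (List; []; _∷_; _++_; _∷ʳ_; length; reverse; last; find; drop; map; filter; allFin)
import Data.List.Properties as Listₚ
open import Data.List.Membership.Propositional using () renaming (_∈_ to _∈ₗ_; _∉_ to _∉ₗ_)
import Data.List.Membership.Propositional.Properties as Memₚ
open import Data.List.Relation.Binary.Disjoint.Propositional using (Disjoint)
import Data.List.Relation.Binary.Permutation.Setoid as Perm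
import Data.List.Relation.Binary.Permutation.Setoid.Properties as Permₚ
open import Data.List.Relation.Binary.Subset.Propositional using () renaming (_⊆_ to _⊆ₗ_)
open import Data.List.Relation.Unary.All as All using (All; []; _∷_)
import Data.List.Relation.Unary.All.Properties as Allₚ
open import Data.List.Relation.Unary.Any as Any using (Any; here; there; any?)
import Data.List.Relation.Unary.Any.Properties as Anyₚ
import Data.List.Relation.Unary.First as First
import Data.List.Relation.Unary.First.Properties as Firstₚ
open import Data.List.Relation.Unary.Unique.Propositional using (Unique; []; _∷_)
import Data.List.Relation.Unary.Unique.Propositional.Properties as Uniqueₚ
open import Data.List.Reverse using (reverseView; []; _∶_∶ʳ_)
open import Data.Maybe using (just; fromMaybe)
open import Data.Nat using (ℕ; zero; suc; _+_; _*_; _∸_; _≤_; z≤n; s≤s)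
import Data.Nat.Properties as ℕₚ
open import Data.Nat.Tactic.RingSolver using (solve-∀)
open import Data.Product using (∃; ∃₂; _×_; _,_; proj₁; proj₂; map₁)
open import Data.Rational using (ℚ; 0ℚ) renaming (_<_ to _<ℚ_; _≤_ to _≤ℚ_)
import Data.Rational.Properties as ℚₚ
open import Data.Sum as Sum using (_⊎_; inj₁; inj₂)
open import Data.Vec using ([]; _∷_; tabulate; lookup; here; there)
import Data.Vec.Properties as Vecₚ
open import Function using (_∘_; case_of_)
open import Function.Bundles using (_⇔_; Equivalence)
open import Relation.Binary.PropositionalEquality
  using (_≡_; _≢_; refl; sym; trans; cong; cong₂; subst; setoid; module ≡-Reasoning)
open import Relation.Nullary using (¬_; Dec; yes; no; does; ¬?; _×-dec_)
open import Relation.Nullary.Decidable as Dec using (dec-true)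
open import Relation.Unary using (Decidable)

module _ {A : Set} where

  Unique-++⁻ˡ : ∀ (xs : List A) {ys} → Unique (xs ++ ys) → Unique xs
  Unique-++⁻ˡ []       _          = []
  Unique-++⁻ˡ (x ∷ xs) (x∉ ∷ xs!) = Allₚ.++⁻ˡ xs x∉ ∷ Unique-++⁻ˡ xs xs!

  Unique-++⁻ʳ : ∀ (xs : List A) {ys} → Unique (xs ++ ys) → Unique ys
  Unique-++⁻ʳ []       ys!       = ys!
  Unique-++⁻ʳ (x ∷ xs) (_ ∷ xs!) = Unique-++⁻ʳ xs xs!

  Unique-++⁻-disjoint : ∀ (xs : List A) {ys} → Unique (xs ++ ys) → Disjoint xs ys
  Unique-++⁻-disjoint (x ∷ xs) (x∉ ∷ _) (here refl , v∈ys) =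
    All.lookup (Allₚ.++⁻ʳ xs x∉) v∈ys refl
  Unique-++⁻-disjoint (x ∷ xs) (_ ∷ xs!) (there v∈xs , v∈ys) =
    Unique-++⁻-disjoint xs xs! (v∈xs , v∈ys)

  Unique-reverse : ∀ {xs : List A} → Unique xs → Unique (reverse xs)
  Unique-reverse {xs} =
    Permₚ.Unique-resp-↭ (setoid A) (Perm.↭-sym (setoid A) (Permₚ.↭-reverse (setoid A) xs))

  Unique-map⁺-on : ∀ {B : Set} {P : A → Set} (f : A → B) →
    (∀ {x y} → P x → P y → f x ≡ f y → x ≡ y) →
    ∀ {xs} → All P xs → Unique xs → Unique (map f xs)
  Unique-map⁺-on f inj []         []          = []
  Unique-map⁺-on f inj (px ∷ pxs) (x∉ ∷ xs!) =
    Allₚ.map⁺ (All.zipWith (λ (x≢y , py) fx≡fy → x≢y (inj px py fx≡fy)) (x∉ , pxs))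
    ∷ Unique-map⁺-on f inj pxs xs!

  find-++-∷ : ∀ {P : A → Set} (P? : Decidable P) xs {y ys} →
    All (¬_ ∘ P) xs → P y → find P? (xs ++ y ∷ ys) ≡ just y
  find-++-∷ P? [] {y} _ py with P? y
  ... | yes _ = refl
  ... | no ¬py = ⊥-elim (¬py py)
  find-++-∷ P? (x ∷ xs) (¬px ∷ ¬pxs) py with P? x
  ... | yes px = ⊥-elim (¬px px)
  ... | no _ = find-++-∷ P? xs ¬pxs py

  first-occurrence : ∀ {P : A → Set} → Decidable P → ∀ {xs} → Any P xs →
    ∃ λ pre → ∃ λ y → ∃ λ post → xs ≡ pre ++ y ∷ post × All (¬_ ∘ P) pre × P y
  first-occurrence P? {xs} any with First.first (Sum.swap ∘ Dec.toSum ∘ P?) xs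
  ... | inj₂ none = ⊥-elim (Allₚ.All¬⇒¬Any none any)
  ... | inj₁ hit with Firstₚ.toView hit
  ...   | ¬pre First.++ py ∷ post = _ , _ , post , refl , ¬pre , py

_∈ₗ?_ : ∀ {n} (x : Fin n) xs → Dec (x ∈ₗ xs)
x ∈ₗ? xs = any? (x ≟ᶠ_) xs

subset : ∀ {n} {P : Fin n → Set} → Decidable P → Subset n
subset P? = tabulate (does ∘ P?)

module _ {n} {P : Fin n → Set} (P? : Decidable P) where

  ∈-subset⁺ : ∀ {v} → P v → v ∈ subset P?
  ∈-subset⁺ {v} pv =
    Vecₚ.lookup⇒[]= v _ (trans (Vecₚ.lookup∘tabulate _ v) (dec-true (P? v) pv))

  ∈-subset⁻ : ∀ {v} → v ∈ subset P? → P v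
  ∈-subset⁻ {v} v∈ = yes⇒ (P? v) (trans (sym (Vecₚ.lookup∘tabulate _ v)) (Vecₚ.[]=⇒lookup v∈))
    where
    yes⇒ : ∀ {Q : Set} (Q? : Dec Q) → does Q? ≡ true → Q
    yes⇒ (yes q) _ = q

private
  dropZero : ∀ {n} → List (Fin (suc n)) → List (Fin n)
  dropZero []           = []
  dropZero (zero ∷ xs)  = dropZero xs
  dropZero (suc i ∷ xs) = i ∷ dropZero xs

  ∈-dropZero : ∀ {n} {i : Fin n} {xs} → suc i ∈ₗ xs → i ∈ₗ dropZero xs
  ∈-dropZero {xs = zero ∷ xs}  (there i∈) = ∈-dropZero i∈
  ∈-dropZero {xs = suc j ∷ xs} (here refl) = here refl
  ∈-dropZero {xs = suc j ∷ xs} (there i∈) = there (∈-dropZero i∈)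

  length-dropZero : ∀ {n} (xs : List (Fin (suc n))) → length (dropZero xs) ≤ length xs
  length-dropZero []           = z≤n
  length-dropZero (zero ∷ xs)  = ℕₚ.m≤n⇒m≤1+n (length-dropZero xs)
  length-dropZero (suc i ∷ xs) = s≤s (length-dropZero xs)

  length-dropZero-< : ∀ {n} (xs : List (Fin (suc n))) → zero ∈ₗ xs →
    suc (length (dropZero xs)) ≤ length xs
  length-dropZero-< (zero ∷ xs)  _          = s≤s (length-dropZero xs)
  length-dropZero-< (suc i ∷ xs) (there 0∈) = s≤s (length-dropZero-< xs 0∈)

∣p∣≤length : ∀ {n} (p : Subset n) xs → (∀ {x} → x ∈ p → x ∈ₗ xs) → ∣ p ∣ ≤ length xs
∣p∣≤length []          xs p⊆xs = z≤n
∣p∣≤length (true ∷ p)  xs p⊆xs = ℕₚ.≤-trans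
  (s≤s (∣p∣≤length p (dropZero xs) (∈-dropZero ∘ p⊆xs ∘ there)))
  (length-dropZero-< xs (p⊆xs here))
∣p∣≤length (false ∷ p) xs p⊆xs = ℕₚ.≤-trans
  (∣p∣≤length p (dropZero xs) (∈-dropZero ∘ p⊆xs ∘ there))
  (length-dropZero xs)

enumerate : ∀ {n} (X : Subset n) → ∃ λ xs → All (_∈ X) xs × Unique xs × (∀ {x} → x ∈ X → x ∈ₗ xs)
enumerate {n} X =
  filter (_∈? X) (allFin n) ,
  Allₚ.all-filter (_∈? X) (allFin n) ,
  Uniqueₚ.filter⁺ (_∈? X) (Uniqueₚ.allFin⁺ n) ,
  Memₚ.∈-filter⁺ (_∈? X) (Memₚ.∈-allFin _)

module _ {n : ℕ} where

  3≤∣p∣ : ∀ (p : Subset n) {x y z} → x ∈ p → y ∈ p → z ∈ p →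
    x ≢ y → x ≢ z → y ≢ z → 3 ≤ ∣ p ∣
  3≤∣p∣ p x∈ y∈ z∈ x≢y x≢z y≢z = ℕₚ.≤-trans
    (s≤s (ℕₚ.≤-trans (s≤s (ℕₚ.≤-trans (s≤s z≤n) (Subsetₚ.x∈p⇒∣p-x∣<∣p∣ z∈p-x-y)))
                     (Subsetₚ.x∈p⇒∣p-x∣<∣p∣ y∈p-x)))
    (Subsetₚ.x∈p⇒∣p-x∣<∣p∣ x∈)
    where
    y∈p-x = Subsetₚ.x∈p∧x≢y⇒x∈p-y y∈ (x≢y ∘ sym)
    z∈p-x-y = Subsetₚ.x∈p∧x≢y⇒x∈p-y (Subsetₚ.x∈p∧x≢y⇒x∈p-y z∈ (x≢z ∘ sym)) (y≢z ∘ sym)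

  two-others : ∀ (p : Subset n) → 3 ≤ ∣ p ∣ → ∀ x →
    ∃₂ λ y z → y ∈ p × z ∈ p × y ≢ z × y ≢ x × z ≢ x
  two-others p 3≤∣p∣ x with Finₚ.any? (λ y → y ∈? p ×-dec ¬? (y ≟ᶠ x))
  ... | no ∄y = ⊥-elim (ℕₚ.<⇒≱ (ℕₚ.≤-trans (s≤s (s≤s z≤n)) 3≤∣p∣) (∣p∣≤length p (x ∷ []) p⊆[x]))
    where
    p⊆[x] : ∀ {z} → z ∈ p → z ∈ₗ x ∷ []
    p⊆[x] {z} z∈ with z ≟ᶠ x
    ... | yes z≡x = here z≡x
    ... | no z≢x = ⊥-elim (∄y (z , z∈ , z≢x))
  ... | yes (y , y∈ , y≢x) with Finₚ.any? (λ z → z ∈? p ×-dec ¬? (z ≟ᶠ x) ×-dec ¬? (z ≟ᶠ y))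
  ...   | yes (z , z∈ , z≢x , z≢y) = y , z , y∈ , z∈ , z≢y ∘ sym , y≢x , z≢x
  ...   | no ∄z = ⊥-elim (ℕₚ.<⇒≱ 3≤∣p∣ (∣p∣≤length p (x ∷ y ∷ []) p⊆[x,y]))
    where
    p⊆[x,y] : ∀ {z} → z ∈ p → z ∈ₗ x ∷ y ∷ []
    p⊆[x,y] {z} z∈ with z ≟ᶠ x | z ≟ᶠ y
    ... | yes z≡x | _       = here z≡x
    ... | no _    | yes z≡y = there (here z≡y)
    ... | no z≢x  | no z≢y  = ⊥-elim (∄z (z , z∈ , z≢x , z≢y))

module GraphProperties {n : ℕ} (G : Graph n) where

  Adj-sym : ∀ {u v} → Adj G u v → Adj G v u
  Adj-sym {u} {v} uv = trans (Graph.sym G v u) uv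

  Adj-irrefl : ∀ {u} → ¬ Adj G u u
  Adj-irrefl {u} uu with trans (sym uu) (Graph.irrefl G u)
  ... | ()

  neighbours : Subset n → Fin n → Subset n
  neighbours K v = tabulate (λ u → lookup K u ∧ Graph.adj G v u)

  ∈-neighbours⁺ : ∀ {K v w} → w ∈ K → Adj G v w → w ∈ neighbours K v
  ∈-neighbours⁺ {K} {v} {w} w∈K vw = Vecₚ.lookup⇒[]= w _
    (trans (Vecₚ.lookup∘tabulate _ w) (cong₂ _∧_ (Vecₚ.[]=⇒lookup w∈K) vw))

  ∈-neighbours⁻ : ∀ {K v w} → w ∈ neighbours K v → w ∈ K × Adj G v w
  ∈-neighbours⁻ {K} {v} {w} w∈ =
    let w∈K , vw = ∧-true (trans (sym (Vecₚ.lookup∘tabulate _ w)) (Vecₚ.[]=⇒lookup w∈))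
    in Vecₚ.lookup⇒[]= w K w∈K , vw
    where
    ∧-true : ∀ {x y} → x ∧ y ≡ true → x ≡ true × y ≡ true
    ∧-true {true} {true} refl = refl , refl

  data Walk : Fin n → Fin n → List (Fin n) → Set where
    stay : ∀ {v} → Walk v v (v ∷ [])
    step : ∀ {u w v ws} → Adj G u w → Walk w v ws → Walk u v (u ∷ ws)

  walk-head : ∀ {u v x xs} → Walk u v (x ∷ xs) → u ≡ x
  walk-head stay       = refl
  walk-head (step _ _) = refl

  walk-last : ∀ {u v xs} → Walk u v xs → v ∈ₗ xs
  walk-last stay       = here refl
  walk-last (step _ p) = there (walk-last p)

  walk-first : ∀ {u v xs} → Walk u v xs → u ∈ₗ xs
  walk-first stay       = here refl
  walk-first (step _ _) = here refl

  walk-cons : ∀ {u v xs} → Walk u v xs → ∃ λ ys → xs ≡ u ∷ ys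
  walk-cons stay       = _ , refl
  walk-cons (step _ _) = _ , refl

  infixr 5 _++ʷ_
  _++ʷ_ : ∀ {u v w xs ys} → Walk u v xs → Walk v w ys → Walk u w (xs ++ drop 1 ys)
  stay     ++ʷ stay       = stay
  stay     ++ʷ step a q   = step a q
  step a p ++ʷ q          = step a (p ++ʷ q)

  reverseʷ : ∀ {u v xs} → Walk u v xs → Walk v u (reverse xs)
  reverseʷ stay = stay
  reverseʷ {u} (step {ws = ws} a p) rewrite Listₚ.unfold-reverse u ws =
    reverseʷ p ++ʷ step (Adj-sym a) stay

  splitʷ : ∀ xs {u v w ys} → Walk u v (xs ++ w ∷ ys) →
    Walk u w (xs ++ w ∷ []) × Walk w v (w ∷ ys)
  splitʷ []           stay          = stay , stay
  splitʷ []           p@(step _ _)  = stay , p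
  splitʷ (x ∷ [])     (step a p)    with walk-head p
  ... | refl = step a stay , p
  splitʷ (x ∷ y ∷ xs) (step a p)    with walk-head p
  ... | refl = map₁ (step a) (splitʷ (y ∷ xs) p)

  Adj-consecutive : ∀ xs {u v x y ys} → Walk u v (xs ++ x ∷ y ∷ ys) → Adj G x y
  Adj-consecutive xs p with splitʷ xs p
  ... | _ , step a q with walk-head q
  ...   | refl = a

  Walk⇒Chain : ∀ {u v xs} → Walk u v xs → Chain G xs × last xs ≡ just v
  Walk⇒Chain stay                = one _ , refl
  Walk⇒Chain (step a p@stay)     = cons a (proj₁ (Walk⇒Chain p)) , proj₂ (Walk⇒Chain p)
  Walk⇒Chain (step a p@(step _ _)) = cons a (proj₁ (Walk⇒Chain p)) , proj₂ (Walk⇒Chain p)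

  Chain⇒Walk : ∀ {u v xs} → Chain G (u ∷ xs) → last (u ∷ xs) ≡ just v → Walk u v (u ∷ xs)
  Chain⇒Walk {xs = []}    (one _)     refl = stay
  Chain⇒Walk {xs = _ ∷ _} (cons a ch) eq   = step a (Chain⇒Walk ch eq)

  PathIn⇒Walk : ∀ {S u v vs} → PathIn G S u v vs → Walk u v vs × Unique vs × All (_∈ S) vs
  PathIn⇒Walk {vs = _ ∷ _} (ch , vs! , vs⊆S , refl , lst) = Chain⇒Walk ch lst , vs! , vs⊆S

  Walk⇒PathIn : ∀ {S u v vs} → Walk u v vs → Unique vs → All (_∈ S) vs → PathIn G S u v vs
  Walk⇒PathIn p vs! vs⊆S with walk-cons p
  ... | _ , refl = proj₁ (Walk⇒Chain p) , vs! , vs⊆S , refl , proj₂ (Walk⇒Chain p)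

  erase : ∀ {u v xs} → Walk u v xs → ∃ λ ys → Walk u v ys × Unique ys × ys ⊆ₗ xs
  erase stay = _ , stay , [] ∷ [] , λ y∈ → y∈
  erase {u} (step a p) with erase p
  ... | ys , q , ys! , ys⊆ with u ∈ₗ? ys
  ...   | no u∉ys = u ∷ ys , step a q , Allₚ.¬Any⇒All¬ ys u∉ys ∷ ys! ,
                    λ { (here refl) → here refl ; (there y∈) → there (ys⊆ y∈) }
  ...   | yes u∈ys with Memₚ.∈-∃++ u∈ys
  ...     | pre , post , refl =
              u ∷ post , proj₂ (splitʷ pre q) , Unique-++⁻ʳ pre ys! , there ∘ ys⊆ ∘ Memₚ.∈-++⁺ʳ pre

  MinSubtree-∅ : ∀ {S X K} → MinSubtree G S X K → (∀ {x} → x ∉ X) → ∀ {v} → v ∉ K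
  MinSubtree-∅ (_ , _ , _ , K-min) X-empty v∈K =
    Subsetₚ.∉⊥ (K-min ∅ (⊥-elim ∘ X-empty) (⊥-elim ∘ Subsetₚ.∉⊥)
                      (λ _ _ u∈∅ → ⊥-elim (Subsetₚ.∉⊥ u∈∅)) v∈K)

module TreeProperties {n : ℕ} (G : Graph n) (tree : IsTree G) where
  open GraphProperties G

  -- The only use of acyclicity.
  head-no-chord : ∀ {u b t qs a} → Adj G u b → Walk b t qs → Unique (u ∷ qs) →
    Adj G u a → a ∈ₗ qs → a ≡ b
  head-no-chord ub q u∷qs! ua a∈qs with Memₚ.∈-∃++ a∈qs
  ... | [] , _ , refl = sym (walk-head q)
  ... | c ∷ pre , post , refl = ⊥-elim (proj₂ tree _ cycle)
    where
    p = step ub (proj₁ (splitʷ (c ∷ pre) q))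
    cycle : IsCycle G (_ ∷ c ∷ pre ++ _ ∷ [])
    cycle = proj₁ (Walk⇒Chain p)
          , Unique-++⁻ˡ (_ ∷ c ∷ pre ++ _ ∷ [])
              (subst Unique (cong (λ l → _ ∷ c ∷ l) (sym (Listₚ.++-assoc pre _ post))) u∷qs!)
          , s≤s (s≤s (subst (1 ≤_) (sym (Listₚ.length-++-sucʳ pre _ [])) (s≤s z≤n)))
          , _ , proj₂ (Walk⇒Chain p) , Adj-sym ua

  closed-path : ∀ {u xs} → Walk u u xs → Unique xs → xs ≡ u ∷ []
  closed-path stay       _        = refl
  closed-path (step _ p) (u∉ ∷ _) = ⊥-elim (All.lookup u∉ (walk-last p) refl)

  path-unique : ∀ {u v xs ys} → Walk u v xs → Unique xs → Walk u v ys → Unique ys → xs ≡ ys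
  path-unique stay         _   q    ys! = sym (closed-path q ys!)
  path-unique p@(step _ _) xs! stay _   = closed-path p xs!
  path-unique {u} (step {w = a} ua p) (u∉as ∷ as!) (step {w = b} {ws = bs} ub q) ys!@(_ ∷ bs!)
    with a ≟ᶠ b
  ... | yes refl = cong (_ ∷_) (path-unique p as! q bs!)
  ... | no a≢b with a ∈ₗ? bs | a ≟ᶠ u
  ...   | yes a∈bs | _        = ⊥-elim (a≢b (head-no-chord ub q ys! ua a∈bs))
  ...   | no _     | yes refl = ⊥-elim (Adj-irrefl ua)
  ...   | no a∉bs  | no a≢u   =
    ⊥-elim (All.lookup u∉as (subst (_ ∈ₗ_) (sym as≡) (there (here refl))) refl)
    where
    as≡ = path-unique p as! (step (Adj-sym ua) (step ub q))
                             ((a≢u ∷ Allₚ.¬Any⇒All¬ bs a∉bs) ∷ ys!)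

  -- The vertices of the u–v path, endpoints included (the paper's 𝒫(u,v) omits them).
  π : Fin n → Fin n → List (Fin n)
  π u v = proj₁ (proj₂ (proj₁ tree) u v Subsetₚ.∈⊤ Subsetₚ.∈⊤)

  private
    π-path : ∀ u v → Walk u v (π u v) × Unique (π u v) × All (_∈ ⊤) (π u v)
    π-path u v = PathIn⇒Walk (proj₂ (proj₂ (proj₁ tree) u v Subsetₚ.∈⊤ Subsetₚ.∈⊤))

  π-walk : ∀ u v → Walk u v (π u v)
  π-walk u v = proj₁ (π-path u v)

  π-Unique : ∀ u v → Unique (π u v)
  π-Unique u v = proj₁ (proj₂ (π-path u v))

  path≡π : ∀ {u v xs} → Walk u v xs → Unique xs → xs ≡ π u v
  path≡π p xs! = path-unique p xs! (π-walk _ _) (π-Unique _ _)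

  PathIn⇒π : ∀ {S u v vs} → PathIn G S u v vs → vs ≡ π u v
  PathIn⇒π path = let p , vs! , _ = PathIn⇒Walk path in path≡π p vs!

  π-self : ∀ u → π u u ≡ u ∷ []
  π-self u = sym (path≡π stay ([] ∷ []))

  π-reverse : ∀ u v → π v u ≡ reverse (π u v)
  π-reverse u v = sym (path≡π (reverseʷ (π-walk u v)) (Unique-reverse (π-Unique u v)))

  ∈-π-sym : ∀ {u v y} → y ∈ₗ π u v → y ∈ₗ π v u
  ∈-π-sym {u} {v} y∈ = subst (_ ∈ₗ_) (sym (π-reverse u v)) (Anyₚ.reverse⁺ y∈)

  π-head : ∀ u v → ∃ λ ys → π u v ≡ u ∷ ys
  π-head u v = walk-cons (π-walk u v)

  π-step : ∀ {u v} → u ≢ v → ∃₂ λ p ys → π u v ≡ u ∷ p ∷ ys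
  π-step {u} {v} u≢v = go (π-walk u v)
    where
    go : ∀ {xs} → Walk u v xs → ∃₂ λ p ys → xs ≡ u ∷ p ∷ ys
    go stay       = ⊥-elim (u≢v refl)
    go (step _ q) = let ys , eq = walk-cons q in _ , ys , cong (u ∷_) eq

  π-prefix : ∀ {u v w} xs {ys} → π u v ≡ xs ++ w ∷ ys → π u w ≡ xs ++ w ∷ []
  π-prefix {u} {v} {w} xs {ys} eq = sym (path≡π
    (proj₁ (splitʷ xs (subst (Walk u v) eq (π-walk u v))))
    (Unique-++⁻ˡ (xs ++ w ∷ [])
      (subst Unique (trans eq (sym (Listₚ.++-assoc xs (w ∷ []) ys))) (π-Unique u v))))

  π-suffix : ∀ {u v w} xs {ys} → π u v ≡ xs ++ w ∷ ys → π w v ≡ w ∷ ys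
  π-suffix {u} {v} xs eq = sym (path≡π
    (proj₂ (splitʷ xs (subst (Walk u v) eq (π-walk u v))))
    (Unique-++⁻ʳ xs (subst Unique eq (π-Unique u v))))

  π-prefix-⊆ : ∀ {u v w} → w ∈ₗ π u v → π u w ⊆ₗ π u v
  π-prefix-⊆ w∈ {y} y∈ with Memₚ.∈-∃++ w∈
  ... | xs , _ , eq with Memₚ.∈-++⁻ xs (subst (y ∈ₗ_) (π-prefix xs eq) y∈)
  ...   | inj₁ y∈xs        = subst (y ∈ₗ_) (sym eq) (Memₚ.∈-++⁺ˡ y∈xs)
  ...   | inj₂ (here refl) = subst (y ∈ₗ_) (sym eq) (Memₚ.∈-++⁺ʳ xs (here refl))

  π-suffix-⊆ : ∀ {u v w} → w ∈ₗ π u v → π w v ⊆ₗ π u v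
  π-suffix-⊆ w∈ {y} y∈ with Memₚ.∈-∃++ w∈
  ... | xs , _ , eq = subst (y ∈ₗ_) (sym eq) (Memₚ.∈-++⁺ʳ xs (subst (y ∈ₗ_) (π-suffix xs eq) y∈))

  π-extend : ∀ {u v w} → Adj G w u → w ∉ₗ π u v → π w v ≡ w ∷ π u v
  π-extend {u} {v} wu w∉ = sym (path≡π (step wu (π-walk u v))
                                       (Allₚ.¬Any⇒All¬ (π u v) w∉ ∷ π-Unique u v))

  π-extend-neighbour : ∀ {u v w p ys} → π u v ≡ u ∷ p ∷ ys → Adj G u w → w ≢ p →
    π w v ≡ w ∷ π u v
  π-extend-neighbour {u} {v} {w} eq uw w≢p = π-extend (Adj-sym uw) w∉
    where
    path = subst (Walk u v) eq (π-walk u v)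
    w∉ : w ∉ₗ π u v
    w∉ w∈ with subst (w ∈ₗ_) eq w∈
    ... | here refl = Adj-irrefl uw
    ... | there w∈p∷ys = w≢p (head-no-chord (Adj-consecutive [] path)
      (proj₂ (splitʷ (u ∷ []) path)) (subst Unique eq (π-Unique u v)) uw w∈p∷ys)

  π-triangle : ∀ {u v y} w → y ∈ₗ π u v → y ∈ₗ π u w ⊎ y ∈ₗ π w v
  π-triangle {u} {v} w y∈ with erase (π-walk u w ++ʷ π-walk w v)
  ... | ys , p , ys! , ys⊆ with Memₚ.∈-++⁻ (π u w) (ys⊆ (subst (_ ∈ₗ_) (sym (path≡π p ys!)) y∈))
  ...   | inj₁ y∈uw = inj₁ y∈uw
  ...   | inj₂ y∈wv = inj₂ (∈-drop-1 (π w v) y∈wv)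
    where
    ∈-drop-1 : ∀ xs {x} → x ∈ₗ drop 1 xs → x ∈ₗ xs
    ∈-drop-1 (_ ∷ _) x∈ = there x∈

  π-join : ∀ {u v w} → (∀ {y} → y ∈ₗ π u w → y ∈ₗ π w v → y ≡ w) → w ∈ₗ π u v
  π-join {u} {v} {w} meet with π-head w v
  ... | ys , πwv≡ = subst (w ∈ₗ_) (path≡π walk walk!) (Memₚ.∈-++⁺ˡ (walk-last (π-walk u w)))
    where
    walk = π-walk u w ++ʷ subst (Walk w v) πwv≡ (π-walk w v)
    w∷ys! = subst Unique πwv≡ (π-Unique w v)
    walk! : Unique (π u w ++ ys)
    walk! = Uniqueₚ.++⁺ (π-Unique u w) (Unique-++⁻ʳ (w ∷ []) w∷ys!) λ (y∈uw , y∈ys) →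
      let y≡w = meet y∈uw (subst (_ ∈ₗ_) (sym πwv≡) (there y∈ys))
      in Uniqueₚ.Unique[x∷xs]⇒x∉xs w∷ys! (subst (_∈ₗ ys) y≡w y∈ys)

  π-⊆ : ∀ {S u v} → Preconnected G S → u ∈ S → v ∈ S → All (_∈ S) (π u v)
  π-⊆ {S} S-conn u∈ v∈ = let vs , path = S-conn _ _ u∈ v∈ in
    subst (All (_∈ S)) (PathIn⇒π path) (proj₂ (proj₂ (PathIn⇒Walk path)))

  π-closed⇒Preconnected : ∀ {S} → (∀ {u v} → u ∈ S → v ∈ S → All (_∈ S) (π u v)) →
    Preconnected G S
  π-closed⇒Preconnected closed u v u∈ v∈ =
    π u v , Walk⇒PathIn (π-walk u v) (π-Unique u v) (closed u∈ v∈)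

  Avoids : Subset n → Fin n → Fin n → Set
  Avoids Y u v = ∀ w → w ≢ u → w ≢ v → w ∈ₗ π u v → w ∉ Y

  Avoids-sym : ∀ {Y u v} → Avoids Y u v → Avoids Y v u
  Avoids-sym avoids w w≢v w≢u w∈ = avoids w w≢u w≢v (∈-π-sym w∈)

  Inner⇒∈π : ∀ {S u v w} → Inner G S u v w → w ∈ₗ π u v
  Inner⇒∈π (_ , _ , _ , path , w∈) = subst (_ ∈ₗ_) (PathIn⇒π path) w∈

  ∈π⇒Inner : ∀ {S u v w} → Preconnected G S → u ∈ S → v ∈ S →
    w ≢ u → w ≢ v → w ∈ₗ π u v → Inner G S u v w
  ∈π⇒Inner {u = u} {v} S-conn u∈ v∈ w≢u w≢v w∈ =
    w≢u , w≢v , π u v , Walk⇒PathIn (π-walk u v) (π-Unique u v) (π-⊆ S-conn u∈ v∈) , w∈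

  GoodPair⇒Avoids : ∀ {S Y u v} → Preconnected G S → u ∈ S → v ∈ S →
    GoodPair G S Y u v → u ≢ v × Avoids Y u v
  GoodPair⇒Avoids {u = u} S-conn u∈ v∈ ((w , w≢u , w≢v , w-inner) , inner∉Y) =
    u≢v , λ w w≢u w≢v w∈ → inner∉Y w (∈π⇒Inner S-conn u∈ v∈ w≢u w≢v w∈)
    where
    u≢v : u ≢ _
    u≢v refl with subst (w ∈ₗ_) (π-self u) (Inner⇒∈π (w≢u , w≢v , w-inner))
    ... | here w≡u = w≢u w≡u

  module _ {P : Fin n → Set} (P? : Decidable P) where

    private
      π-within? : ∀ x v → Dec (All P (π x v))
      π-within? x v = All.all? P? (π x v)

    component : Fin n → Subset n
    component x = subset (π-within? x)

    ∈-component⁺ : ∀ {x v} → All P (π x v) → v ∈ component x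
    ∈-component⁺ {x} = ∈-subset⁺ (π-within? x)

    ∈-component⁻ : ∀ {x v} → v ∈ component x → All P (π x v)
    ∈-component⁻ {x} = ∈-subset⁻ (π-within? x)

    x∈component : ∀ {x} → P x → x ∈ component x
    x∈component {x} px = ∈-component⁺ (subst (All P) (sym (π-self x)) (px ∷ []))

    component⊆P : ∀ {x v} → v ∈ component x → P v
    component⊆P {x} {v} v∈ = All.lookup (∈-component⁻ v∈) (walk-last (π-walk x v))

    component-π-closed : ∀ {x v y} → v ∈ component x → y ∈ₗ π x v → y ∈ component x
    component-π-closed v∈ y∈ =
      ∈-component⁺ (All.tabulate (All.lookup (∈-component⁻ v∈) ∘ π-prefix-⊆ y∈))

    component-Connected : ∀ {x} → P x → Connected G (component x)
    component-Connected {x} px = (x , x∈component px) , π-closed⇒Preconnected closed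
      where
      closed : ∀ {u v} → u ∈ component x → v ∈ component x → All (_∈ component x) (π u v)
      closed u∈ v∈ = All.tabulate λ y∈ → case π-triangle x y∈ of λ
        { (inj₁ y∈ux) → component-π-closed u∈ (∈-π-sym y∈ux)
        ; (inj₂ y∈xv) → component-π-closed v∈ y∈xv }

    component-maximal : ∀ {H x} → Preconnected G H → x ∈ H → (∀ {v} → v ∈ H → P v) →
      H ⊆ component x
    component-maximal H-conn x∈ H⊆P v∈ = ∈-component⁺ (All.map H⊆P (π-⊆ H-conn x∈ v∈))

module _ {n : ℕ} (G : Graph n) (tree : IsTree G) (c : Fin n → ℚ) (a : ℚ) where
  open TreeProperties G tree

  heavy? : Decidable (λ v → a <ℚ c v)
  heavy? v = a ℚₚ.<? c v

  component-HeavyIn : ∀ {x} → a <ℚ c x → HeavyIn G ⊤ c a (component heavy? x)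
  component-HeavyIn x-heavy =
    (λ _ → Subsetₚ.∈⊤) , component-Connected heavy? x-heavy , (λ _ → component⊆P heavy?) ,
    λ H C⊆H _ H-conn H-heavy →
      component-maximal heavy? (proj₂ H-conn) (C⊆H (x∈component heavy? x-heavy)) (H-heavy _)

  HeavyIn-⊇-component : ∀ {S H x y} → Preconnected G S → HeavyIn G S c a H → x ∈ H →
    y ∈ S → y ∈ component heavy? x → y ∈ H
  HeavyIn-⊇-component {S} {H} {x} {y} S-conn (H⊆S , H-conn , H-heavy , H-max) x∈H y∈S y∈C =
    H-max C H⊆C C⊆S (component-Connected S-heavy? (H⊆S x∈H , H-heavy x x∈H))
      (λ _ → proj₂ ∘ component⊆P S-heavy?) y∈C'
    where
    S-heavy? : Decidable (λ v → v ∈ S × a <ℚ c v)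
    S-heavy? v = v ∈? S ×-dec heavy? v
    C = component S-heavy? x
    H⊆C : H ⊆ C
    H⊆C = component-maximal S-heavy? (proj₂ H-conn) x∈H (λ {v} v∈H → H⊆S v∈H , H-heavy v v∈H)
    C⊆S : C ⊆ S
    C⊆S = proj₁ ∘ component⊆P S-heavy?
    y∈C' : y ∈ C
    y∈C' = ∈-component⁺ S-heavy? (All.zip (π-⊆ S-conn (H⊆S x∈H) y∈S , ∈-component⁻ heavy? y∈C))

  representatives-bound : ∀ {k S X} → UpModular G c k → 0ℚ ≤ℚ a → Preconnected G S →
    (∀ H → HeavyIn G S c a H → ∃ λ x → x ∈ X × x ∈ H × (∀ y → y ∈ X → y ∈ H → y ≡ x)) →
    (∀ x → x ∈ X → ∃ λ H → HeavyIn G S c a H × x ∈ H) →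
    ∀ {xs} → All (_∈ X) xs → Unique xs → length xs ≤ k
  representatives-bound {k} {S} {X} up-mod 0≤a S-conn unique-rep X⊆modules {xs} xs⊆X xs! =
    subst (_≤ k) (Listₚ.length-map (component heavy?) xs)
      (up-mod a 0≤a (map (component heavy?) xs)
        (Unique-map⁺-on (component heavy?) component-injective xs⊆X xs!)
        (Allₚ.map⁺ (All.map (component-HeavyIn ∘ X-heavy) xs⊆X)))
    where
    X-heavy : ∀ {x} → x ∈ X → a <ℚ c x
    X-heavy {x} x∈X = let _ , (_ , _ , H-heavy , _) , x∈H = X⊆modules x x∈X in H-heavy x x∈H

    X⊆S : ∀ {x} → x ∈ X → x ∈ S
    X⊆S {x} x∈X = let _ , (H⊆S , _) , x∈H = X⊆modules x x∈X in H⊆S x∈H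

    component-injective : ∀ {x y} → x ∈ X → y ∈ X →
      component heavy? x ≡ component heavy? y → x ≡ y
    component-injective {x} {y} x∈X y∈X Cx≡Cy =
      let H , H-module , x∈H = X⊆modules x x∈X
          r , _ , _ , r-unique = unique-rep H H-module
          y∈H = HeavyIn-⊇-component S-conn H-module x∈H (X⊆S y∈X)
                  (subst (y ∈_) (sym Cx≡Cy) (x∈component heavy? (X-heavy y∈X)))
      in trans (r-unique x x∈X x∈H) (sym (r-unique y y∈X y∈H))

module RootedTree {n : ℕ} (G : Graph n) (tree : IsTree G) (r : Fin n) where
  open GraphProperties G
  open TreeProperties G tree

  ρ : Fin n → List (Fin n)
  ρ v = π v r

  ChildOf : Fin n → Fin n → Set
  ChildOf w c = ρ c ≡ c ∷ ρ w

  ρ-split : ∀ {u w} → w ∈ₗ ρ u → ∃ λ A → ρ u ≡ A ++ ρ w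
  ρ-split {u} {w} w∈ with Memₚ.∈-∃++ w∈
  ... | A , R , eq = A , trans eq (cong (A ++_) (sym (π-suffix A eq)))

  ρ-below : ∀ {u w y} A → ρ u ≡ A ++ ρ w → y ∈ₗ A → w ∈ₗ ρ y
  ρ-below {u} {w} {y} A eq y∈A with Memₚ.∈-∃++ y∈A
  ... | C , D , refl = subst (w ∈ₗ_) (sym ρy≡) (Memₚ.∈-++⁺ʳ (y ∷ D) (walk-first (π-walk w r)))
    where
    ρy≡ : ρ y ≡ y ∷ D ++ ρ w
    ρy≡ = π-suffix C (trans eq (Listₚ.++-assoc C (y ∷ D) (ρ w)))

  children-on-path : ∀ {w c₁ c₂ u} → ChildOf w c₁ → ChildOf w c₂ →
    c₁ ∈ₗ ρ u → c₂ ∈ₗ ρ u → c₁ ≡ c₂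
  children-on-path {w} {c₁} {c₂} {u} ch₁ ch₂ c₁∈ c₂∈ with ρ-split c₁∈ | ρ-split c₂∈
  ... | A₁ , e₁ | A₂ , e₂ = proj₂ (Listₚ.∷ʳ-injective A₁ A₂ (Listₚ.++-cancelʳ (ρ w) _ _ (begin
    (A₁ ∷ʳ c₁) ++ ρ w  ≡⟨ Listₚ.++-assoc A₁ _ _ ⟩
    A₁ ++ c₁ ∷ ρ w     ≡⟨ cong (A₁ ++_) ch₁ ⟨
    A₁ ++ ρ c₁          ≡⟨ e₁ ⟨
    ρ u                 ≡⟨ e₂ ⟩
    A₂ ++ ρ c₂          ≡⟨ cong (A₂ ++_) ch₂ ⟩
    A₂ ++ c₂ ∷ ρ w     ≡⟨ Listₚ.++-assoc A₂ _ _ ⟨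
    (A₂ ∷ʳ c₂) ++ ρ w  ∎)))
    where open ≡-Reasoning

  child-before : ∀ {u w} A {R} → ρ u ≡ A ++ w ∷ R → w ≢ u → ∃ λ c → ChildOf w c × c ∈ₗ A
  child-before {u} A eq w≢u with reverseView A
  ... | [] = ⊥-elim (w≢u (sym (walk-head (subst (Walk u r) eq (π-walk u r)))))
  ... | A₀ ∶ _ ∶ʳ c = c , ρc≡ , Memₚ.∈-++⁺ʳ A₀ (here refl)
    where
    eq′ = trans eq (Listₚ.++-assoc A₀ (c ∷ []) _)
    ρc≡ : ChildOf _ c
    ρc≡ = trans (π-suffix A₀ eq′) (cong (c ∷_) (sym (π-suffix (A₀ ∷ʳ c) eq)))

  child-adjacent : ∀ {w c} → ChildOf w c → Adj G c w
  child-adjacent {w} {c} ch with π-head w r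
  ... | R , ρw≡ = Adj-consecutive [] (subst (Walk c r) (trans ch (cong (c ∷_) ρw≡)) (π-walk c r))

  child-not-parent : ∀ {w c p R} → ChildOf w c → ρ w ≡ w ∷ p ∷ R → c ≢ p
  child-not-parent {c = c} ch ρw≡ refl with subst Unique (trans ch (cong (c ∷_) ρw≡)) (π-Unique c r)
  ... | c∉ ∷ _ = All.lookup c∉ (there (here refl)) refl

  two-children⇒branch : ∀ {K w c₁ c₂} → w ≢ r → All (_∈ K) (ρ w) →
    ChildOf w c₁ → ChildOf w c₂ → c₁ ≢ c₂ → c₁ ∈ K → c₂ ∈ K → 3 ≤ deg G K w
  two-children⇒branch {K} {w} w≢r ρw⊆K ch₁ ch₂ c₁≢c₂ c₁∈K c₂∈K with π-step w≢r
  ... | p , R , ρw≡ = 3≤∣p∣ (neighbours K w)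
    (∈-neighbours⁺ c₁∈K (Adj-sym (child-adjacent ch₁)))
    (∈-neighbours⁺ c₂∈K (Adj-sym (child-adjacent ch₂)))
    (∈-neighbours⁺ (All.lookup ρw⊆K p∈ρw) (Adj-consecutive [] (subst (Walk w r) ρw≡ (π-walk w r))))
    c₁≢c₂ (child-not-parent ch₁ ρw≡) (child-not-parent ch₂ ρw≡)
    where
    p∈ρw = subst (p ∈ₗ_) (sym ρw≡) (there (here refl))

  branch⇒two-children : ∀ {K w} → w ≢ r → 3 ≤ deg G K w →
    ∃₂ λ c₁ c₂ → ChildOf w c₁ × ChildOf w c₂ × c₁ ≢ c₂ × c₁ ∈ K × c₂ ∈ K
  branch⇒two-children {K} {w} w≢r 3≤deg with π-step w≢r
  ... | p , R , ρw≡ with two-others (neighbours K w) 3≤deg p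
  ...   | c₁ , c₂ , c₁∈ , c₂∈ , c₁≢c₂ , c₁≢p , c₂≢p =
    c₁ , c₂ , child c₁∈ c₁≢p , child c₂∈ c₂≢p , c₁≢c₂ ,
    proj₁ (∈-neighbours⁻ {K} c₁∈) , proj₁ (∈-neighbours⁻ {K} c₂∈)
    where
    child : ∀ {c} → c ∈ neighbours K w → c ≢ p → ChildOf w c
    child c∈ c≢p = π-extend-neighbour ρw≡ (proj₂ (∈-neighbours⁻ {K} c∈)) c≢p

  Covered : List (Fin n) → Fin n → Set
  Covered ts v = Any (λ t → v ∈ₗ ρ t) ts

  Covered? : ∀ ts → Decidable (Covered ts)
  Covered? ts v = any? (λ t → v ∈ₗ? ρ t) ts

  Covered-ancestor : ∀ {ts w y} → Covered ts w → y ∈ₗ ρ w → Covered ts y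
  Covered-ancestor cov y∈ = Any.map (λ w∈ → π-suffix-⊆ w∈ y∈) cov

  Covered-Preconnected : ∀ ts → Preconnected G (subset (Covered? ts))
  Covered-Preconnected ts = π-closed⇒Preconnected λ u∈ v∈ → All.tabulate λ y∈ →
    ∈-subset⁺ (Covered? ts) (case π-triangle r y∈ of λ
      { (inj₁ y∈ρu) → Covered-ancestor (∈-subset⁻ (Covered? ts) u∈) y∈ρu
      ; (inj₂ y∈πrv) → Covered-ancestor (∈-subset⁻ (Covered? ts) v∈) (∈-π-sym y∈πrv) })

  -- attach ts lists, for each t ∈ ts, where the root path of t first meets those of r and
  -- of the terminals listed after t.
  attachment : List (Fin n) → Fin n → Fin n
  attachment ts t = fromMaybe r (find (Covered? ts) (ρ t))

  attach : List (Fin n) → List (Fin n)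
  attach []       = []
  attach (t ∷ ts) = attachment (r ∷ ts) t ∷ attach ts

  length-attach : ∀ ts → length (attach ts) ≡ length ts
  length-attach []       = refl
  length-attach (t ∷ ts) = cong suc (length-attach ts)

  attachment-child : ∀ ts {t w c} → ChildOf w c → c ∈ₗ ρ t →
    ¬ Covered ts c → Covered ts w → attachment ts t ≡ w
  attachment-child ts {t} {w} {c} ch c∈ ¬cov-c cov-w with ρ-split c∈ | π-head w r
  ... | A , ρt≡ | R , ρw≡ = cong (fromMaybe r) (begin
    find (Covered? ts) (ρ t)                  ≡⟨ cong (find (Covered? ts)) ρt≡′ ⟩
    find (Covered? ts) ((A ∷ʳ c) ++ w ∷ R)    ≡⟨ find-++-∷ (Covered? ts) (A ∷ʳ c) uncovered cov-w ⟩
    just w                                      ∎)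
    where
    open ≡-Reasoning
    ρt≡′ : ρ t ≡ (A ∷ʳ c) ++ w ∷ R
    ρt≡′ = trans ρt≡ (trans (cong (A ++_) (trans ch (cong (c ∷_) ρw≡)))
                            (sym (Listₚ.++-assoc A (c ∷ []) (w ∷ R))))
    uncovered : All (¬_ ∘ Covered ts) (A ∷ʳ c)
    uncovered = Allₚ.∷ʳ⁺
      (All.tabulate λ y∈A cov-y → ¬cov-c (Covered-ancestor cov-y (ρ-below A ρt≡ y∈A))) ¬cov-c

  Covered-∷ : ∀ {t ts v} → Covered (r ∷ t ∷ ts) v → v ∈ₗ ρ t ⊎ Covered (r ∷ ts) v
  Covered-∷ (here v∈)          = inj₂ (here v∈)
  Covered-∷ (there (here v∈))  = inj₁ v∈
  Covered-∷ (there (there v∈)) = inj₂ (there v∈)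

  attach-lone-child : ∀ {t ts w c₁ c₂} → ChildOf w c₁ → ChildOf w c₂ → c₁ ≢ c₂ →
    ¬ Covered (r ∷ ts) c₁ → Covered (r ∷ t ∷ ts) c₁ → Covered (r ∷ t ∷ ts) c₂ →
    attachment (r ∷ ts) t ≡ w
  attach-lone-child ch₁ ch₂ c₁≢c₂ ¬cov₁ cov₁ cov₂ with Covered-∷ cov₁ | Covered-∷ cov₂
  ... | inj₂ cov₁′ | _          = ⊥-elim (¬cov₁ cov₁′)
  ... | inj₁ c₁∈   | inj₁ c₂∈   = ⊥-elim (c₁≢c₂ (children-on-path ch₁ ch₂ c₁∈ c₂∈))
  ... | inj₁ c₁∈   | inj₂ cov₂′ = attachment-child _ ch₁ c₁∈ ¬cov₁
    (Covered-ancestor cov₂′ (subst (_ ∈ₗ_) (sym ch₂) (there (walk-first (π-walk _ r)))))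

  attach-branch : ∀ ts {w c₁ c₂} → ChildOf w c₁ → ChildOf w c₂ → c₁ ≢ c₂ →
    Covered (r ∷ ts) c₁ → Covered (r ∷ ts) c₂ → w ∈ₗ attach ts
  attach-branch [] ch₁ ch₂ c₁≢c₂ (here c₁∈) (here c₂∈) =
    ⊥-elim (c₁≢c₂ (children-on-path ch₁ ch₂ c₁∈ c₂∈))
  attach-branch (t ∷ ts) ch₁ ch₂ c₁≢c₂ cov₁ cov₂ with Covered? (r ∷ ts) _ | Covered? (r ∷ ts) _
  ... | yes cov₁′ | yes cov₂′ = there (attach-branch ts ch₁ ch₂ c₁≢c₂ cov₁′ cov₂′)
  ... | no ¬cov₁  | _         = here (sym (attach-lone-child ch₁ ch₂ c₁≢c₂ ¬cov₁ cov₁ cov₂))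
  ... | yes _     | no ¬cov₂  = here (sym (attach-lone-child ch₂ ch₁ (c₁≢c₂ ∘ sym) ¬cov₂ cov₂ cov₁))

  branch∈attach : ∀ {K} ts → (∀ {v} → v ∈ K → Covered (r ∷ ts) v) →
    ∀ {w} → w ≢ r → 3 ≤ deg G K w → w ∈ₗ attach ts
  branch∈attach ts K⊆cov w≢r 3≤deg with branch⇒two-children w≢r 3≤deg
  ... | _ , _ , ch₁ , ch₂ , c₁≢c₂ , c₁∈K , c₂∈K =
    attach-branch ts ch₁ ch₂ c₁≢c₂ (K⊆cov c₁∈K) (K⊆cov c₂∈K)

  MinSubtree⊆Covered : ∀ {S X K ts} → Preconnected G S → MinSubtree G S X K →
    All (_∈ X) (r ∷ ts) → (∀ {x} → x ∈ X → x ∈ₗ r ∷ ts) → ∀ {v} → v ∈ K → Covered (r ∷ ts) v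
  MinSubtree⊆Covered {S} {X} {K} {ts} S-conn (X⊆K , K⊆S , _ , K-min) xs⊆X X⊆xs v∈K =
    ∈-subset⁻ (Covered? (r ∷ ts)) (K-min _ X⊆C C⊆S (Covered-Preconnected (r ∷ ts)) v∈K)
    where
    xs⊆S : All (_∈ S) (r ∷ ts)
    xs⊆S = All.map (K⊆S ∘ X⊆K) xs⊆X
    X⊆C : X ⊆ subset (Covered? (r ∷ ts))
    X⊆C x∈X = ∈-subset⁺ (Covered? (r ∷ ts))
      (Any.map (λ { refl → walk-first (π-walk _ r) }) (X⊆xs x∈X))
    C⊆S : subset (Covered? (r ∷ ts)) ⊆ S
    C⊆S v∈C = All.lookupWith (λ t∈S v∈ρt → All.lookup (π-⊆ S-conn t∈S (All.head xs⊆S)) v∈ρt)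
                             xs⊆S (∈-subset⁻ (Covered? (r ∷ ts)) v∈C)

  terminal-or-branch∈ : ∀ {X K} ts → (∀ {x} → x ∈ X → x ∈ₗ r ∷ ts) →
    (∀ {v} → v ∈ K → Covered (r ∷ ts) v) →
    ∀ {y} → y ∈ X ⊎ (y ∈ K × 3 ≤ deg G K y) → y ∈ₗ r ∷ ts ++ attach ts
  terminal-or-branch∈ ts X⊆xs K⊆cov (inj₁ y∈X) with X⊆xs y∈X
  ... | here y≡r    = here y≡r
  ... | there y∈ts  = there (Memₚ.∈-++⁺ˡ y∈ts)
  terminal-or-branch∈ ts X⊆xs K⊆cov {y} (inj₂ (_ , 3≤deg)) with y ≟ᶠ r
  ... | yes y≡r = here y≡r
  ... | no y≢r  = there (Memₚ.∈-++⁺ʳ ts (branch∈attach ts K⊆cov y≢r 3≤deg))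

  length-cover : ∀ ts (g : Fin n → Fin n) →
    length ((r ∷ ts ++ attach ts) ++ map g (ts ++ attach ts))
      ≡ suc ((length ts + length ts) + (length ts + length ts))
  length-cover ts g = cong suc (begin
    length (rest ++ map g rest)          ≡⟨ Listₚ.length-++ rest ⟩
    length rest + length (map g rest)    ≡⟨ cong (length rest +_) (Listₚ.length-map g rest) ⟩
    length rest + length rest            ≡⟨ cong (λ l → l + l) length-rest ⟩
    (length ts + length ts) + (length ts + length ts) ∎)
    where
    open ≡-Reasoning
    rest = ts ++ attach ts
    length-rest : length rest ≡ length ts + length ts
    length-rest = trans (Listₚ.length-++ ts) (cong (length ts +_) (length-attach ts))

  meet∈π : ∀ {u v L} A {R} → ρ u ≡ A ++ L ∷ R → All (_∉ₗ ρ v) A → L ∈ₗ ρ v → L ∈ₗ π u v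
  meet∈π {u} {v} {L} A ρu≡ A∉ρv L∈ρv = π-join meets-at-L
    where
    meets-at-L : ∀ {y} → y ∈ₗ π u L → y ∈ₗ π L v → y ≡ L
    meets-at-L {y} y∈uL y∈Lv with Memₚ.∈-++⁻ A (subst (y ∈ₗ_) (π-prefix A ρu≡) y∈uL)
    ... | inj₁ y∈A        = ⊥-elim (All.lookup A∉ρv y∈A (π-prefix-⊆ L∈ρv (∈-π-sym y∈Lv)))
    ... | inj₂ (here y≡L) = y≡L

  -- The first Y-vertex strictly above y (r if there is none).
  up : Subset n → Fin n → Fin n
  up Y y = fromMaybe r (find (_∈? Y) (drop 1 (ρ y)))

  module BranchClosed {K Y : Subset n} (K-conn : Preconnected G K) (Y⊆K : Y ⊆ K) (r∈Y : r ∈ Y)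
           (branch⊆Y : ∀ {v} → v ∈ K → 3 ≤ deg G K v → v ∈ Y) where

    up-ancestor : ∀ {u v} → u ≢ v → v ∈ Y → v ∈ₗ ρ u → Avoids Y u v → u ≢ r × v ≡ up Y u
    up-ancestor {u} {v} u≢v v∈Y v∈ρu avoids with Memₚ.∈-∃++ v∈ρu | π-head u r
    ... | [] , R , ρu≡ | _ , ρu≡′ = ⊥-elim (u≢v (Listₚ.∷-injectiveˡ (trans (sym ρu≡′) ρu≡)))
    ... | a ∷ A , R , ρu≡ | _ , ρu≡′ with Listₚ.∷-injectiveˡ (trans (sym ρu≡′) ρu≡)
    ...   | refl = u≢r , cong (fromMaybe r) (begin
      just v                       ≡⟨ find-++-∷ (_∈? Y) A A∉Y v∈Y ⟨
      find (_∈? Y) (A ++ v ∷ R)    ≡⟨ cong (find (_∈? Y) ∘ drop 1) ρu≡ ⟨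
      find (_∈? Y) (drop 1 (ρ u))  ∎)
      where
      open ≡-Reasoning
      ρu! : Unique (u ∷ A ++ v ∷ R)
      ρu! = subst Unique ρu≡ (π-Unique u r)
      A∉Y : All (_∉ Y) A
      A∉Y = All.tabulate λ {w} w∈A → avoids w
        (λ { refl → Uniqueₚ.Unique[x∷xs]⇒x∉xs ρu! (Memₚ.∈-++⁺ˡ w∈A) })
        (λ { refl → Unique-++⁻-disjoint (u ∷ A) ρu! (there w∈A , here refl) })
        (subst (w ∈ₗ_) (sym (π-prefix (u ∷ A) ρu≡)) (there (Memₚ.∈-++⁺ˡ w∈A)))
      u≢r : u ≢ r
      u≢r refl with subst (v ∈ₗ_) (π-self u) v∈ρu
      ... | here v≡u = u≢v (sym v≡u)

    meet∈Y : ∀ {u v} → u ∈ K → v ∈ K → v ∉ₗ ρ u → u ∉ₗ ρ v →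
      ∃ λ L → L ∈ Y × L ≢ u × L ≢ v × L ∈ₗ π u v
    meet∈Y {u} {v} u∈K v∈K v∉ρu u∉ρv
      with first-occurrence (_∈ₗ? ρ v)
             (Any.map (λ { refl → walk-last (π-walk v r) }) (walk-last (π-walk u r)))
    ... | A , L , _ , ρu≡ , A∉ρv , L∈ρv with Memₚ.∈-∃++ L∈ρv
    ...   | B , _ , ρv≡ = L , L∈Y , L≢u , L≢v , meet∈π A ρu≡ A∉ρv L∈ρv
      where
      L∈ρu : L ∈ₗ ρ u
      L∈ρu = subst (L ∈ₗ_) (sym ρu≡) (Memₚ.∈-++⁺ʳ A (here refl))
      L≢u : L ≢ u
      L≢u refl = u∉ρv L∈ρv
      L≢v : L ≢ v
      L≢v refl = v∉ρu L∈ρu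
      ρu⊆K = π-⊆ K-conn u∈K (Y⊆K r∈Y)
      ρv⊆K = π-⊆ K-conn v∈K (Y⊆K r∈Y)
      -- Unless L = r, L has a child towards u, a child towards v and a parent.
      L∈Y : L ∈ Y
      L∈Y with L ≟ᶠ r | child-before A ρu≡ L≢u | child-before B ρv≡ L≢v
      ... | yes refl | _ | _ = r∈Y
      ... | no L≢r | c₁ , ch₁ , c₁∈A | c₂ , ch₂ , c₂∈B = branch⊆Y (All.lookup ρu⊆K L∈ρu)
        (two-children⇒branch L≢r (All.tabulate (All.lookup ρu⊆K ∘ π-suffix-⊆ L∈ρu)) ch₁ ch₂
          (λ { refl → All.lookup A∉ρv c₁∈A c₂∈ρv })
          (All.lookup ρu⊆K (subst (c₁ ∈ₗ_) (sym ρu≡) (Memₚ.∈-++⁺ˡ c₁∈A)))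
          (All.lookup ρv⊆K c₂∈ρv))
        where
        c₂∈ρv = subst (c₂ ∈ₗ_) (sym ρv≡) (Memₚ.∈-++⁺ˡ c₂∈B)

    consecutive-in-Y : ∀ {u v} → u ∈ Y → v ∈ Y → u ≢ v → Avoids Y u v →
      (u ≢ r × v ≡ up Y u) ⊎ (v ≢ r × u ≡ up Y v)
    consecutive-in-Y {u} {v} u∈Y v∈Y u≢v avoids with v ∈ₗ? ρ u | u ∈ₗ? ρ v
    ... | yes v∈ρu | _        = inj₁ (up-ancestor u≢v v∈Y v∈ρu avoids)
    ... | no _     | yes u∈ρv = inj₂ (up-ancestor (u≢v ∘ sym) u∈Y u∈ρv (Avoids-sym avoids))
    ... | no v∉ρu  | no u∉ρv  =
      let L , L∈Y , L≢u , L≢v , L∈π = meet∈Y (Y⊆K u∈Y) (Y⊆K v∈Y) v∉ρu u∉ρv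
      in ⊥-elim (avoids L L≢u L≢v L∈π L∈Y)

    pair-via-up : ∀ (m : Fin n → Fin n → Fin n) → (∀ u v → m u v ≡ m v u) →
      ∀ {u v} → u ∈ Y → v ∈ Y → u ≢ v → Avoids Y u v →
      ∃ λ w → w ∈ Y × w ≢ r × m u v ≡ m w (up Y w)
    pair-via-up m m-sym {u} {v} u∈Y v∈Y u≢v avoids with consecutive-in-Y u∈Y v∈Y u≢v avoids
    ... | inj₁ (u≢r , v≡up) = u , u∈Y , u≢r , cong (m u) v≡up
    ... | inj₂ (v≢r , u≡up) = v , v∈Y , v≢r , trans (m-sym u v) (cong (m v) u≡up)

    Z-cover : ∀ {rest} (m : Fin n → Fin n → Fin n) → (∀ u v → m u v ≡ m v u) →
      (∀ {y} → y ∈ Y → y ∈ₗ r ∷ rest) →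
      ∀ {z} → z ∈ Y ⊎ (∃₂ λ u v → u ∈ Y × v ∈ Y × u ≢ v × Avoids Y u v × z ≡ m u v) →
      z ∈ₗ (r ∷ rest) ++ map (λ u → m u (up Y u)) rest
    Z-cover m m-sym Y⊆ (inj₁ z∈Y) = Memₚ.∈-++⁺ˡ (Y⊆ z∈Y)
    Z-cover {rest} m m-sym Y⊆ (inj₂ (u , v , u∈Y , v∈Y , u≢v , avoids , refl))
      with pair-via-up m m-sym u∈Y v∈Y u≢v avoids
    ... | w , w∈Y , w≢r , muv≡ with Y⊆ w∈Y
    ...   | here w≡r   = ⊥-elim (w≢r w≡r)
    ...   | there w∈rest = Memₚ.∈-++⁺ʳ (r ∷ rest)
      (subst (_∈ₗ map pair-point rest) (sym muv≡) (Memₚ.∈-map⁺ pair-point w∈rest))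
      where pair-point = λ u → m u (up Y u)

module Construction {n} {T : Graph n} (tree : IsTree T) {S X K Y Z : Subset n}
  {m : Fin n → Fin n → Fin n} (S-conn : Preconnected T S) (K-min : MinSubtree T S X K)
  (Y-def : ∀ y → (y ∈ Y) ⇔ (y ∈ X ⊎ (y ∈ K × 3 ≤ deg T K y)))
  (m-sym : ∀ u v → m u v ≡ m v u)
  (Z-def : ∀ z → (z ∈ Z) ⇔ (z ∈ Y ⊎
    (∃ λ u → ∃ λ v → u ∈ Y × v ∈ Y × GoodPair T S Y u v × z ≡ m u v)))
  where
  open GraphProperties T using (MinSubtree-∅)
  open TreeProperties T tree using (Avoids; GoodPair⇒Avoids)

  private
    X⊆K = proj₁ K-min
    K⊆S = proj₁ (proj₂ K-min)
    Y⇒ = λ {y} → Equivalence.to (Y-def y)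
    Y⇐ = λ {y} → Equivalence.from (Y-def y)

    Y⊆K : Y ⊆ K
    Y⊆K = Sum.[ X⊆K , proj₁ ] ∘ Y⇒

    Z⊆Y∪pairs : ∀ {z} → z ∈ Z →
      z ∈ Y ⊎ (∃₂ λ u v → u ∈ Y × v ∈ Y × u ≢ v × Avoids Y u v × z ≡ m u v)
    Z⊆Y∪pairs z∈Z = Sum.map₂ avoiding (Equivalence.to (Z-def _) z∈Z)
      where
      avoiding = λ (u , v , u∈Y , v∈Y , good , z≡) →
        let u≢v , avoids = GoodPair⇒Avoids S-conn (K⊆S (Y⊆K u∈Y)) (K⊆S (Y⊆K v∈Y)) good
        in u , v , u∈Y , v∈Y , u≢v , avoids , z≡

  Z-empty : (∀ {x} → x ∉ X) → ∀ {z} → z ∉ Z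
  Z-empty X-empty = Sum.[ Y-empty , (λ (_ , _ , u∈Y , _) → Y-empty u∈Y) ] ∘ Z⊆Y∪pairs
    where
    Y-empty : ∀ {y} → y ∉ Y
    Y-empty = Sum.[ X-empty , MinSubtree-∅ K-min X-empty ∘ proj₁ ] ∘ Y⇒

  ∣Z∣≤4∣ts∣+1 : ∀ {r ts} → All (_∈ X) (r ∷ ts) → (∀ {x} → x ∈ X → x ∈ₗ r ∷ ts) →
    ∣ Z ∣ ≤ suc ((length ts + length ts) + (length ts + length ts))
  ∣Z∣≤4∣ts∣+1 {r} {ts} xs⊆X X⊆xs = begin
    ∣ Z ∣                                   ≤⟨ ∣p∣≤length Z _ Z⊆cover ⟩
    length (cover ++ map pair-point rest)   ≡⟨ length-cover ts pair-point ⟩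
    suc ((length ts + length ts) + (length ts + length ts)) ∎
    where
    open ℕₚ.≤-Reasoning
    open RootedTree T tree r
    open BranchClosed (proj₁ (proj₂ (proj₂ K-min))) Y⊆K (Y⇐ (inj₁ (All.head xs⊆X)))
                      (λ v∈K 3≤deg → Y⇐ (inj₂ (v∈K , 3≤deg)))
    rest = ts ++ attach ts
    cover = r ∷ rest
    pair-point = λ u → m u (up Y u)
    Y⊆cover : ∀ {y} → y ∈ Y → y ∈ₗ cover
    Y⊆cover = terminal-or-branch∈ ts X⊆xs (MinSubtree⊆Covered S-conn K-min xs⊆X X⊆xs) ∘ Y⇒
    Z⊆cover : ∀ {z} → z ∈ Z → z ∈ₗ cover ++ map pair-point rest
    Z⊆cover = Z-cover m m-sym Y⊆cover ∘ Z⊆Y∪pairs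

4L+1≤4k∸3 : ∀ {L k} → suc L ≤ k → suc ((L + L) + (L + L)) ≤ 4 * k ∸ 3
4L+1≤4k∸3 {L} {k} L<k = begin
  suc ((L + L) + (L + L))            ≡⟨ ℕₚ.m+n∸m≡n 3 _ ⟨
  (3 + suc ((L + L) + (L + L))) ∸ 3  ≡⟨ cong (_∸ 3) (4*[1+L]≡ L) ⟨
  4 * suc L ∸ 3                      ≤⟨ ℕₚ.∸-monoˡ-≤ 3 (ℕₚ.*-monoʳ-≤ 4 L<k) ⟩
  4 * k ∸ 3                          ∎
  where
  open ℕₚ.≤-Reasoning
  4*[1+L]≡ : ∀ L → 4 * suc L ≡ 3 + suc ((L + L) + (L + L))
  4*[1+L]≡ = solve-∀

lemma11 : (n : ℕ) (T : Graph n) → IsTree T →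
    (c : Fin n → ℚ) → (∀ v → 0ℚ <ℚ c v) →
    (k : ℕ) → UpModular T c k →
    (S : Subset n) → IsSubtree T S →
    (a : ℚ) → 0ℚ ≤ℚ a →
    (X : Subset n) →
    (∀ H → HeavyIn T S c a H →
      ∃ λ x → x ∈ X × x ∈ H × (∀ y → y ∈ X → y ∈ H → y ≡ x)) →
    (∀ x → x ∈ X → ∃ λ H → HeavyIn T S c a H × x ∈ H) →
    (K : Subset n) → MinSubtree T S X K →
    (Y : Subset n) →
    (∀ y → (y ∈ Y) ⇔ (y ∈ X ⊎ (y ∈ K × 3 ≤ deg T K y))) →
    (m : Fin n → Fin n → Fin n) →
    (∀ u v → m u v ≡ m v u) →
    (∀ u v → u ∈ Y → v ∈ Y → GoodPair T S Y u v →
      Inner T S u v (m u v) × (∀ w → Inner T S u v w → c (m u v) ≤ℚ c w)) →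
    (Z : Subset n) →
    (∀ z → (z ∈ Z) ⇔ (z ∈ Y ⊎
      (∃ λ u → ∃ λ v → u ∈ Y × v ∈ Y × GoodPair T S Y u v × z ≡ m u v))) →
    ∣ Z ∣ ≤ 4 * k ∸ 3
lemma11 n T tree c _ k up-mod S (_ , S-conn) a 0≤a X X-reps X⊆modules
        K K-min Y Y-def m m-sym _ Z Z-def
  with enumerate X
... | [] , _ , _ , X⊆[] =
  ℕₚ.≤-trans (∣p∣≤length Z [] (⊥-elim ∘ Z-empty (Anyₚ.¬Any[] ∘ X⊆[]))) z≤n
  where open Construction tree S-conn K-min Y-def m-sym Z-def
... | r ∷ ts , xs⊆X , xs! , X⊆xs = ℕₚ.≤-trans (∣Z∣≤4∣ts∣+1 xs⊆X X⊆xs)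
  (4L+1≤4k∸3 (representatives-bound T tree c a up-mod 0≤a S-conn X-reps X⊆modules xs⊆X xs!))
  where open Construction tree S-conn K-min Y-def m-sym Z-def
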